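{- Let $\lambda\geq 1$, $m\geq 0$, $n\geq 0$ and $t\geq 1$ be integers. Then $$\overline a_{2^\lambda m+t}(n)\equiv \overline a_t(n)\pmod{2^{\lambda+1}}.$$
   Context: For $|q|<1$ and a positive integer $h$, write $f_h=(q^h;q^h)_\infty=\prod_{k\geq 1}(1-q^{hk})$. For a positive integer $c$, the generalized overcubic partition function $\overline a_c(n)$ is defined by the generating function $\sum_{n\geq 0}\overline a_c(n)q^n=\dfrac{f_4^{c-1}}{f_1^2f_2^{2c-3}}$. -}

module Defs where

open import Data.Nat as ℕ using (ℕ; zero; suc; _∸_)
open import Data.Nat.Divisibility using (_∣?_)
open import Data.Integer as ℤ using (ℤ; +_; -[1+_])
open import Data.List using (List; foldr; map; upTo)
open import Data.Bool using (if_then_else_)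
open import Relation.Nullary.Decidable using (does)

Series : Set
Series = ℕ → ℤ

sumℤ : List ℤ → ℤ
sumℤ = foldr ℤ._+_ (+ 0)

_⊛_ : Series → Series → Series
(a ⊛ b) n = sumℤ (map (λ i → a i ℤ.* b (n ∸ i)) (upTo (suc n)))

oneS : Series
oneS zero    = + 1
oneS (suc _) = + 0

powS : Series → ℕ → Series
powS s zero    = oneS
powS s (suc k) = s ⊛ powS s k

-- the series 1 - q^m   (used only with m ≥ 1)
binomS : ℕ → Series
binomS m n = if does (n ℕ.≟ 0) then + 1 else (if does (n ℕ.≟ m) then -[1+ 0 ] else + 0)

-- the series 1/(1 - q^m) = Σ_j q^{mj}   (used only with m ≥ 1)
geomS : ℕ → Series
geomS m n = if does (m ∣? n) then + 1 else + 0

factorPow : ℕ → ℤ → Series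
factorPow m (+ k)     = powS (binomS m) k
factorPow m -[1+ k ]  = powS (geomS m) (suc k)

-- k-th factor of f_4^{c-1} / (f_1^2 f_2^{2c-3}):
-- (1-q^{4k})^{c-1} (1-q^k)^{-2} (1-q^{2k})^{-(2c-3)}
overcubicFactor : ℕ → ℕ → Series
overcubicFactor c k =
  factorPow (4 ℕ.* k) (+ c ℤ.- + 1)
  ⊛ (factorPow k (ℤ.- + 2)
  ⊛ factorPow (2 ℕ.* k) (ℤ.- (+ (2 ℕ.* c) ℤ.- + 3)))

prodTo : (ℕ → Series) → ℕ → Series
prodTo F zero    = oneS
prodTo F (suc N) = F (suc N) ⊛ prodTo F N

-- \overline a_c(n): the n-th coefficient of f_4^{c-1}/(f_1^2 f_2^{2c-3}).
-- Factors with index k > n are 1 + O(q^{k}) and do not affect the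
-- coefficient of q^n, so the product may be truncated at k = n.
abar : ℕ → ℕ → ℤ
abar c n = prodTo (overcubicFactor c) n n

{-# OPTIONS --safe #-}

-- Since (1 - x)² = 1 - 2x + x², we have
-- 1 - q^{4k} ≡ (1 - q^{2k})² (mod 2), and squaring turns a congruence mod 2^j
-- into one mod 2^{j+1}; hence (1 - q^{4k})^{2^λ m} ≡ (1 - q^{2k})^{2^{λ+1} m}
-- (mod 2^{λ+1}). Replacing c by c + 2^λ m multiplies the k-th factor
-- (1 - q^{4k})^{c-1} (1 - q^k)^{-2} (1 - q^{2k})^{-(2c-3)} by exactly
-- (1 - q^{4k})^{2^λ m} (1 - q^{2k})^{-2^{λ+1} m}, which is therefore ≡ 1,
-- and congruences of factors multiply.

module Submission where

module OvercubicCongruence where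

  open import Data.Bool using (true; false; if_then_else_)
  open import Data.Integer using (ℤ; +_; -[1+_]; -1ℤ; _+_; _*_; -_; _-_)
  import Data.Integer.Properties as ℤₚ
  open import Data.Integer.Divisibility using () renaming (_∣_ to _∣ᵤ_)
  open import Data.Integer.Divisibility.Signed
    using (_∣_; divides; ∣m∣n⇒∣m+n; ∣m⇒∣-m; ∣n⇒∣m*n; ∣m⇒∣m*n; ∣⇒∣ᵤ)
  open import Data.Integer.Tactic.RingSolver using (solve-∀)
  open import Data.List using (applyUpTo)
  open import Data.List.Properties using (map-upTo)
  open import Data.Nat as ℕ using (ℕ; zero; suc; _^_; _∸_)
  import Data.Nat.Divisibility as ℕ∣
  import Data.Nat.Properties as ℕₚ
  open import Data.Product using (_,_)
  open import Function using (_∘_; mk⇔)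
  open import Relation.Binary using (Setoid)
  open import Relation.Binary.PropositionalEquality
  import Relation.Binary.Reasoning.Setoid as SetoidReasoning
  open import Relation.Nullary using (yes; no)
  open import Relation.Nullary.Decidable using (does; does-⇔; dec-true; dec-false)
  open import Defs

  module ≗-Reasoning = SetoidReasoning (ℕ →-setoid ℤ)

  tail : Series → Series
  tail a n = a (suc n)

  0ₛ : Series
  0ₛ _ = + 0

  infixl 6 _+ₛ_
  _+ₛ_ : Series → Series → Series
  (a +ₛ b) n = a n + b n

  infixr 7 _·_
  _·_ : ℤ → Series → Series
  (s · a) n = s * a n

  tail-⊛ : ∀ a b → tail (a ⊛ b) ≗ a 0 · tail b +ₛ tail a ⊛ b
  tail-⊛ a b n =
    trans (⊛-as-applyUpTo a b (suc n))
          (cong (_+_ (a 0 * b (suc n))) (sym (⊛-as-applyUpTo (tail a) b n)))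
    where
    ⊛-as-applyUpTo : ∀ a b n → (a ⊛ b) n ≡ sumℤ (applyUpTo (λ i → a i * b (n ∸ i)) (suc n))
    ⊛-as-applyUpTo a b n = cong sumℤ (map-upTo (λ i → a i * b (n ∸ i)) (suc n))

  tail-⊛ʳ : ∀ a b → tail (a ⊛ b) ≗ a ⊛ tail b +ₛ b 0 · tail a
  tail-⊛ʳ a b zero = trans (tail-⊛ a b 0) (rearrange (a 0) (b 1) (a 1) (b 0))
    where
    rearrange : ∀ x y z w → x * y + (z * w + + 0) ≡ (x * y + + 0) + w * z
    rearrange = solve-∀
  tail-⊛ʳ a b (suc n) = begin
    (a ⊛ b) (suc (suc n))
      ≡⟨ tail-⊛ a b (suc n) ⟩
    x + (tail a ⊛ b) (suc n)
      ≡⟨ cong (_+_ x) (tail-⊛ʳ (tail a) b n) ⟩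
    x + ((tail a ⊛ tail b) n + y)
      ≡⟨ ℤₚ.+-assoc x ((tail a ⊛ tail b) n) y ⟨
    (x + (tail a ⊛ tail b) n) + y
      ≡⟨ cong₂ _+_ (tail-⊛ a (tail b) n) refl ⟨
    (a ⊛ tail b) (suc n) + y
      ∎
    where
    open ≡-Reasoning
    x = a 0 * b (suc (suc n))
    y = b 0 * a (suc (suc n))

  ⊛-cong : ∀ {a a′ b b′} → a ≗ a′ → b ≗ b′ → a ⊛ b ≗ a′ ⊛ b′
  ⊛-cong a≗a′ b≗b′ zero = cong (_+ + 0) (cong₂ _*_ (a≗a′ 0) (b≗b′ 0))
  ⊛-cong {a} {a′} {b} {b′} a≗a′ b≗b′ (suc n) = begin
    (a ⊛ b) (suc n)
      ≡⟨ tail-⊛ a b n ⟩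
    a 0 * b (suc n) + (tail a ⊛ b) n
      ≡⟨ cong₂ _+_ (cong₂ _*_ (a≗a′ 0) (b≗b′ (suc n))) (⊛-cong (a≗a′ ∘ suc) b≗b′ n) ⟩
    a′ 0 * b′ (suc n) + (tail a′ ⊛ b′) n
      ≡⟨ tail-⊛ a′ b′ n ⟨
    (a′ ⊛ b′) (suc n)
      ∎
    where open ≡-Reasoning

  ⊛-congˡ : ∀ a {b b′} → b ≗ b′ → a ⊛ b ≗ a ⊛ b′
  ⊛-congˡ a = ⊛-cong {a} {a} (λ _ → refl)

  ⊛-congʳ : ∀ {a a′} b → a ≗ a′ → a ⊛ b ≗ a′ ⊛ b
  ⊛-congʳ {a} {a′} b a≗a′ = ⊛-cong {a} {a′} {b} {b} a≗a′ (λ _ → refl)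

  ⊛-zeroˡ : ∀ b → 0ₛ ⊛ b ≗ 0ₛ
  ⊛-zeroˡ b zero    = refl
  ⊛-zeroˡ b (suc n) = trans (tail-⊛ 0ₛ b n) (trans (ℤₚ.+-identityˡ _) (⊛-zeroˡ b n))

  ⊛-identityˡ : ∀ b → oneS ⊛ b ≗ b
  ⊛-identityˡ b zero    = trans (ℤₚ.+-identityʳ (+ 1 * b 0)) (ℤₚ.*-identityˡ (b 0))
  ⊛-identityˡ b (suc n) = begin
    (oneS ⊛ b) (suc n)             ≡⟨ tail-⊛ oneS b n ⟩
    + 1 * b (suc n) + (0ₛ ⊛ b) n   ≡⟨ cong₂ _+_ (ℤₚ.*-identityˡ (b (suc n))) (⊛-zeroˡ b n) ⟩
    b (suc n) + + 0                ≡⟨ ℤₚ.+-identityʳ (b (suc n)) ⟩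
    b (suc n)                      ∎
    where open ≡-Reasoning

  ⊛-comm : ∀ a b → a ⊛ b ≗ b ⊛ a
  ⊛-comm a b zero    = cong (_+ + 0) (ℤₚ.*-comm (a 0) (b 0))
  ⊛-comm a b (suc n) = begin
    (a ⊛ b) (suc n)          ≡⟨ tail-⊛ a b n ⟩
    x + (tail a ⊛ b) n       ≡⟨ cong (_+_ x) (⊛-comm (tail a) b n) ⟩
    x + (b ⊛ tail a) n       ≡⟨ ℤₚ.+-comm x ((b ⊛ tail a) n) ⟩
    (b ⊛ tail a) n + x       ≡⟨ tail-⊛ʳ b a n ⟨
    (b ⊛ a) (suc n)          ∎
    where
    open ≡-Reasoning
    x = a 0 * b (suc n)

  ⊛-identityʳ : ∀ a → a ⊛ oneS ≗ a
  ⊛-identityʳ a n = trans (⊛-comm a oneS n) (⊛-identityˡ a n)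

  ⊛-distribʳ-+ₛ : ∀ a b c → (a +ₛ b) ⊛ c ≗ a ⊛ c +ₛ b ⊛ c
  ⊛-distribʳ-+ₛ a b c zero = distrib₀ (a 0) (b 0) (c 0)
    where
    distrib₀ : ∀ x y z → (x + y) * z + + 0 ≡ (x * z + + 0) + (y * z + + 0)
    distrib₀ = solve-∀
  ⊛-distribʳ-+ₛ a b c (suc n) = begin
    ((a +ₛ b) ⊛ c) (suc n)
      ≡⟨ tail-⊛ (a +ₛ b) c n ⟩
    (a 0 + b 0) * c (suc n) + ((tail a +ₛ tail b) ⊛ c) n
      ≡⟨ cong (_+_ ((a 0 + b 0) * c (suc n))) (⊛-distribʳ-+ₛ (tail a) (tail b) c n) ⟩
    (a 0 + b 0) * c (suc n) + ((tail a ⊛ c) n + (tail b ⊛ c) n)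
      ≡⟨ distrib (a 0) (b 0) (c (suc n)) ((tail a ⊛ c) n) ((tail b ⊛ c) n) ⟩
    (a 0 * c (suc n) + (tail a ⊛ c) n) + (b 0 * c (suc n) + (tail b ⊛ c) n)
      ≡⟨ cong₂ _+_ (tail-⊛ a c n) (tail-⊛ b c n) ⟨
    (a ⊛ c +ₛ b ⊛ c) (suc n)
      ∎
    where
    open ≡-Reasoning
    distrib : ∀ x y z u v → (x + y) * z + (u + v) ≡ (x * z + u) + (y * z + v)
    distrib = solve-∀

  ⊛-distribˡ-+ₛ : ∀ a b c → a ⊛ (b +ₛ c) ≗ a ⊛ b +ₛ a ⊛ c
  ⊛-distribˡ-+ₛ a b c n = begin
    (a ⊛ (b +ₛ c)) n     ≡⟨ ⊛-comm a (b +ₛ c) n ⟩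
    ((b +ₛ c) ⊛ a) n     ≡⟨ ⊛-distribʳ-+ₛ b c a n ⟩
    (b ⊛ a +ₛ c ⊛ a) n   ≡⟨ cong₂ _+_ (⊛-comm b a n) (⊛-comm c a n) ⟩
    (a ⊛ b +ₛ a ⊛ c) n   ∎
    where open ≡-Reasoning

  ⊛-scalarˡ : ∀ s a b → (s · a) ⊛ b ≗ s · (a ⊛ b)
  ⊛-scalarˡ s a b zero = scalar₀ s (a 0) (b 0)
    where
    scalar₀ : ∀ s x y → s * x * y + + 0 ≡ s * (x * y + + 0)
    scalar₀ = solve-∀
  ⊛-scalarˡ s a b (suc n) = begin
    ((s · a) ⊛ b) (suc n)
      ≡⟨ tail-⊛ (s · a) b n ⟩
    s * a 0 * b (suc n) + ((s · tail a) ⊛ b) n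
      ≡⟨ cong (_+_ (s * a 0 * b (suc n))) (⊛-scalarˡ s (tail a) b n) ⟩
    s * a 0 * b (suc n) + s * (tail a ⊛ b) n
      ≡⟨ scalar s (a 0) (b (suc n)) ((tail a ⊛ b) n) ⟩
    s * (a 0 * b (suc n) + (tail a ⊛ b) n)
      ≡⟨ cong (s *_) (tail-⊛ a b n) ⟨
    (s · (a ⊛ b)) (suc n)
      ∎
    where
    open ≡-Reasoning
    scalar : ∀ s x y u → s * x * y + s * u ≡ s * (x * y + u)
    scalar = solve-∀

  ⊛-scalarʳ : ∀ s a b → a ⊛ (s · b) ≗ s · (a ⊛ b)
  ⊛-scalarʳ s a b n = begin
    (a ⊛ (s · b)) n   ≡⟨ ⊛-comm a (s · b) n ⟩
    ((s · b) ⊛ a) n   ≡⟨ ⊛-scalarˡ s b a n ⟩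
    s * (b ⊛ a) n     ≡⟨ cong (s *_) (⊛-comm b a n) ⟩
    s * (a ⊛ b) n     ∎
    where open ≡-Reasoning

  ⊛-assoc : ∀ a b c → (a ⊛ b) ⊛ c ≗ a ⊛ (b ⊛ c)
  ⊛-assoc a b c zero = assoc₀ (a 0) (b 0) (c 0)
    where
    assoc₀ : ∀ x y z → (x * y + + 0) * z + + 0 ≡ x * (y * z + + 0) + + 0
    assoc₀ = solve-∀
  ⊛-assoc a b c (suc n) = begin
    ((a ⊛ b) ⊛ c) (suc n)
      ≡⟨ tail-⊛ (a ⊛ b) c n ⟩
    (a ⊛ b) 0 * c (suc n) + (tail (a ⊛ b) ⊛ c) n
      ≡⟨ cong (_+_ ((a ⊛ b) 0 * c (suc n))) tail-assoc ⟩
    (a ⊛ b) 0 * c (suc n) + (a 0 * (tail b ⊛ c) n + (tail a ⊛ (b ⊛ c)) n)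
      ≡⟨ regroup (a 0) (b 0) (c (suc n)) ((tail b ⊛ c) n) ((tail a ⊛ (b ⊛ c)) n) ⟩
    a 0 * (b 0 * c (suc n) + (tail b ⊛ c) n) + (tail a ⊛ (b ⊛ c)) n
      ≡⟨ cong₂ _+_ (cong (a 0 *_) (tail-⊛ b c n)) refl ⟨
    a 0 * (b ⊛ c) (suc n) + (tail a ⊛ (b ⊛ c)) n
      ≡⟨ tail-⊛ a (b ⊛ c) n ⟨
    (a ⊛ (b ⊛ c)) (suc n)
      ∎
    where
    open ≡-Reasoning
    regroup : ∀ x y z u v → (x * y + + 0) * z + (x * u + v) ≡ x * (y * z + u) + v
    regroup = solve-∀
    tail-assoc : (tail (a ⊛ b) ⊛ c) n ≡ a 0 * (tail b ⊛ c) n + (tail a ⊛ (b ⊛ c)) n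
    tail-assoc = begin
      (tail (a ⊛ b) ⊛ c) n
        ≡⟨ ⊛-congʳ c (tail-⊛ a b) n ⟩
      ((a 0 · tail b +ₛ tail a ⊛ b) ⊛ c) n
        ≡⟨ ⊛-distribʳ-+ₛ (a 0 · tail b) (tail a ⊛ b) c n ⟩
      ((a 0 · tail b) ⊛ c) n + ((tail a ⊛ b) ⊛ c) n
        ≡⟨ cong₂ _+_ (⊛-scalarˡ (a 0) (tail b) c n) (⊛-assoc (tail a) b c n) ⟩
      a 0 * (tail b ⊛ c) n + (tail a ⊛ (b ⊛ c)) n
        ∎

  x⊛yz≗y⊛xz : ∀ a b c → a ⊛ (b ⊛ c) ≗ b ⊛ (a ⊛ c)
  x⊛yz≗y⊛xz a b c = begin
    a ⊛ (b ⊛ c)   ≈⟨ ⊛-assoc a b c ⟨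
    (a ⊛ b) ⊛ c   ≈⟨ ⊛-congʳ c (⊛-comm a b) ⟩
    (b ⊛ a) ⊛ c   ≈⟨ ⊛-assoc b a c ⟩
    b ⊛ (a ⊛ c)   ∎
    where open ≗-Reasoning

  powS-cong : ∀ {a b} k → a ≗ b → powS a k ≗ powS b k
  powS-cong zero    a≗b n = refl
  powS-cong (suc k) a≗b   = ⊛-cong a≗b (powS-cong k a≗b)

  powS-distribˡ-+ : ∀ a i j → powS a (i ℕ.+ j) ≗ powS a i ⊛ powS a j
  powS-distribˡ-+ a zero    j n = sym (⊛-identityˡ (powS a j) n)
  powS-distribˡ-+ a (suc i) j   = begin
    a ⊛ powS a (i ℕ.+ j)        ≈⟨ ⊛-congˡ a (powS-distribˡ-+ a i j) ⟩
    a ⊛ (powS a i ⊛ powS a j)   ≈⟨ ⊛-assoc a (powS a i) (powS a j) ⟨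
    (a ⊛ powS a i) ⊛ powS a j   ∎
    where open ≗-Reasoning

  powS-*-assoc : ∀ a i j → powS (powS a i) j ≗ powS a (i ℕ.* j)
  powS-*-assoc a i zero    n = cong (λ k → powS a k n) (sym (ℕₚ.*-zeroʳ i))
  powS-*-assoc a i (suc j)   = begin
    powS a i ⊛ powS (powS a i) j   ≈⟨ ⊛-congˡ (powS a i) (powS-*-assoc a i j) ⟩
    powS a i ⊛ powS a (i ℕ.* j)    ≈⟨ powS-distribˡ-+ a i (i ℕ.* j) ⟨
    powS a (i ℕ.+ i ℕ.* j)         ≡⟨ cong (powS a) (ℕₚ.*-suc i j) ⟨
    powS a (i ℕ.* suc j)           ∎
    where open ≗-Reasoning

  powS-double : ∀ a i → powS a (2 ℕ.* i) ≗ powS a i ⊛ powS a i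
  powS-double a i = begin
    powS a (2 ℕ.* i)      ≡⟨ cong (λ k → powS a (i ℕ.+ k)) (ℕₚ.+-identityʳ i) ⟩
    powS a (i ℕ.+ i)      ≈⟨ powS-distribˡ-+ a i i ⟩
    powS a i ⊛ powS a i   ∎
    where open ≗-Reasoning

  monomial : ℕ → Series
  monomial j n = if does (n ℕ.≟ j) then + 1 else + 0

  shift : ℕ → Series → Series
  shift zero    b n       = b n
  shift (suc j) b zero    = + 0
  shift (suc j) b (suc n) = shift j b n

  shift-+ : ∀ j b r → shift j b (j ℕ.+ r) ≡ b r
  shift-+ zero    b r = refl
  shift-+ (suc j) b r = shift-+ j b r

  shift-< : ∀ j b {n} → n ℕ.< j → shift j b n ≡ + 0
  shift-< (suc j) b {zero}  _           = refl
  shift-< (suc j) b {suc n} (ℕ.s≤s n<j) = shift-< j b n<j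

  shift-monomial : ∀ i j → shift i (monomial j) ≗ monomial (i ℕ.+ j)
  shift-monomial zero    j n       = refl
  shift-monomial (suc i) j zero    = refl
  shift-monomial (suc i) j (suc n) = shift-monomial i j n

  monomial-⊛ : ∀ j b → monomial j ⊛ b ≗ shift j b
  monomial-⊛ zero b = begin
    monomial 0 ⊛ b   ≈⟨ ⊛-congʳ b monomial-zero ⟩
    oneS ⊛ b         ≈⟨ ⊛-identityˡ b ⟩
    b                ∎
    where
    open ≗-Reasoning
    monomial-zero : monomial 0 ≗ oneS
    monomial-zero zero    = refl
    monomial-zero (suc n) = refl
  monomial-⊛ (suc j) b zero    = refl
  monomial-⊛ (suc j) b (suc n) =
    trans (tail-⊛ (monomial (suc j)) b n) (trans (ℤₚ.+-identityˡ _) (monomial-⊛ j b n))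

  binomS-monomial : ∀ j → binomS (suc j) ≗ oneS +ₛ -1ℤ · monomial (suc j)
  binomS-monomial j zero = refl
  binomS-monomial j (suc n) with does (n ℕ.≟ j)
  ... | true  = refl
  ... | false = refl

  geomS-+ : ∀ s r → geomS s (s ℕ.+ r) ≡ geomS s r
  geomS-+ s r =
    cong (λ b → if b then + 1 else + 0) (does-⇔ s∣s+r⇔s∣r (s ℕ∣.∣? (s ℕ.+ r)) (s ℕ∣.∣? r))
    where
    s∣s+r⇔s∣r = mk⇔ (λ s∣s+r → ℕ∣.∣m+n∣m⇒∣n s∣s+r ℕ∣.∣-refl)
                    (ℕ∣.∣m∣n⇒∣m+n ℕ∣.∣-refl)

  geomS-unfold : ∀ j → geomS (suc j) ≗ oneS +ₛ shift (suc j) (geomS (suc j))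
  geomS-unfold j n with n ℕ.<? suc j
  geomS-unfold j zero    | yes _
    rewrite dec-true (suc j ℕ∣.∣? 0) (suc j ℕ∣.∣0) = refl
  geomS-unfold j (suc n) | yes n<s
    rewrite dec-false (suc j ℕ∣.∣? suc n) (ℕ∣.>⇒∤ n<s)
          | shift-< (suc j) (geomS (suc j)) n<s = refl
  ... | no n≮s with ℕₚ.m≤n⇒∃[o]m+o≡n (ℕₚ.≮⇒≥ n≮s)
  ... | r , refl = begin
    G (suc j ℕ.+ r)                      ≡⟨ geomS-+ (suc j) r ⟩
    G r                                  ≡⟨ ℤₚ.+-identityˡ (G r) ⟨
    + 0 + G r                            ≡⟨ cong (_+_ (+ 0)) (shift-+ (suc j) G r) ⟨
    + 0 + shift (suc j) G (suc j ℕ.+ r)  ∎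
    where
    open ≡-Reasoning
    G = geomS (suc j)

  binomS-⊛-geomS : ∀ j → binomS (suc j) ⊛ geomS (suc j) ≗ oneS
  binomS-⊛-geomS j n = begin
    (binomS (suc j) ⊛ G) n
      ≡⟨ ⊛-congʳ G (binomS-monomial j) n ⟩
    ((oneS +ₛ -1ℤ · x) ⊛ G) n
      ≡⟨ ⊛-distribʳ-+ₛ oneS (-1ℤ · x) G n ⟩
    (oneS ⊛ G) n + ((-1ℤ · x) ⊛ G) n
      ≡⟨ cong₂ _+_ (⊛-identityˡ G n) (⊛-scalarˡ -1ℤ x G n) ⟩
    G n + -1ℤ * (x ⊛ G) n
      ≡⟨ cong₂ (λ u v → u + -1ℤ * v) (geomS-unfold j n) (monomial-⊛ (suc j) G n) ⟩
    (oneS n + shift (suc j) G n) + -1ℤ * shift (suc j) G n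
      ≡⟨ cancel (oneS n) (shift (suc j) G n) ⟩
    oneS n
      ∎
    where
    open ≡-Reasoning
    G = geomS (suc j)
    x = monomial (suc j)
    cancel : ∀ u v → (u + v) + -1ℤ * v ≡ u
    cancel = solve-∀

  binomS-⊛-factorPow : ∀ j w → binomS (suc j) ⊛ factorPow (suc j) w ≗ factorPow (suc j) (w + + 1)
  binomS-⊛-factorPow j (+ i) n = cong (λ k → powS (binomS (suc j)) k n) (ℕₚ.+-comm 1 i)
  binomS-⊛-factorPow j -[1+ zero ] = begin
    B ⊛ (G ⊛ oneS)   ≈⟨ ⊛-congˡ B (⊛-identityʳ G) ⟩
    B ⊛ G            ≈⟨ binomS-⊛-geomS j ⟩
    oneS             ∎
    where
    open ≗-Reasoning
    B = binomS (suc j)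
    G = geomS (suc j)
  binomS-⊛-factorPow j -[1+ suc i ] = begin
    B ⊛ (G ⊛ powS G (suc i))   ≈⟨ ⊛-assoc B G (powS G (suc i)) ⟨
    (B ⊛ G) ⊛ powS G (suc i)   ≈⟨ ⊛-congʳ (powS G (suc i)) (binomS-⊛-geomS j) ⟩
    oneS ⊛ powS G (suc i)      ≈⟨ ⊛-identityˡ (powS G (suc i)) ⟩
    powS G (suc i)             ∎
    where
    open ≗-Reasoning
    B = binomS (suc j)
    G = geomS (suc j)

  powS-binomS-⊛-factorPow : ∀ j i w →
    powS (binomS (suc j)) i ⊛ factorPow (suc j) w ≗ factorPow (suc j) (w + + i)
  powS-binomS-⊛-factorPow j zero w n =
    trans (⊛-identityˡ (F w) n) (cong (λ v → F v n) (sym (ℤₚ.+-identityʳ w)))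
    where F = factorPow (suc j)
  powS-binomS-⊛-factorPow j (suc i) w = begin
    (B ⊛ powS B i) ⊛ F w     ≈⟨ ⊛-assoc B (powS B i) (F w) ⟩
    B ⊛ (powS B i ⊛ F w)     ≈⟨ ⊛-congˡ B (powS-binomS-⊛-factorPow j i w) ⟩
    B ⊛ F (w + + i)          ≈⟨ binomS-⊛-factorPow j (w + + i) ⟩
    F (w + + i + + 1)        ≡⟨ cong F (ℤₚ.+-assoc w (+ i) (+ 1)) ⟩
    F (w + (+ i + + 1))      ≡⟨ cong (λ k → F (w + + k)) (ℕₚ.+-comm i 1) ⟩
    F (w + + suc i)          ∎
    where
    open ≗-Reasoning
    B = binomS (suc j)
    F = factorPow (suc j)

  ∣-diff-+ : ∀ {M} x x′ y y′ → M ∣ x - x′ → M ∣ y - y′ → M ∣ (x + y) - (x′ + y′)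
  ∣-diff-+ x x′ y y′ M∣x-x′ M∣y-y′ =
    subst (_ ∣_) (regroup x x′ y y′) (∣m∣n⇒∣m+n M∣x-x′ M∣y-y′)
    where
    regroup : ∀ x x′ y y′ → (x - x′) + (y - y′) ≡ (x + y) - (x′ + y′)
    regroup = solve-∀

  ∣-diff-* : ∀ {M} x x′ y y′ → M ∣ x - x′ → M ∣ y - y′ → M ∣ x * y - x′ * y′
  ∣-diff-* x x′ y y′ M∣x-x′ M∣y-y′ =
    subst (_ ∣_) (regroup x x′ y y′) (∣m∣n⇒∣m+n (∣n⇒∣m*n x M∣y-y′) (∣m⇒∣m*n y′ M∣x-x′))
    where
    regroup : ∀ x x′ y y′ → x * (y - y′) + (x - x′) * y′ ≡ x * y - x′ * y′
    regroup = solve-∀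

  -- A record rather than a function, so that a and b can be inferred from a proof.
  infix 4 _≡_[mod_]
  record _≡_[mod_] (a b : Series) (M : ℕ) : Set where
    constructor coefficientwise
    field
      coeff : ∀ n → + M ∣ a n - b n
  open _≡_[mod_]

  ≗⇒≡-mod : ∀ {M a b} → a ≗ b → a ≡ b [mod M ]
  ≗⇒≡-mod {M} {a} {b} a≗b = coefficientwise λ n →
    divides (+ 0) (trans (cong (_- b n) (a≗b n)) (ℤₚ.+-inverseʳ (b n)))

  ≡-mod-refl : ∀ {M a} → a ≡ a [mod M ]
  ≡-mod-refl = ≗⇒≡-mod (λ _ → refl)

  ≡-mod-sym : ∀ {M a b} → a ≡ b [mod M ] → b ≡ a [mod M ]
  ≡-mod-sym {a = a} {b} a≡b = coefficientwise λ n →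
    subst (_ ∣_) (negate (a n) (b n)) (∣m⇒∣-m (coeff a≡b n))
    where
    negate : ∀ x y → - (x - y) ≡ y - x
    negate = solve-∀

  ≡-mod-trans : ∀ {M a b c} → a ≡ b [mod M ] → b ≡ c [mod M ] → a ≡ c [mod M ]
  ≡-mod-trans {a = a} {b} {c} a≡b b≡c = coefficientwise λ n →
    subst (_ ∣_) (telescope (a n) (b n) (c n)) (∣m∣n⇒∣m+n (coeff a≡b n) (coeff b≡c n))
    where
    telescope : ∀ x y z → (x - y) + (y - z) ≡ x - z
    telescope = solve-∀

  ≡-mod-setoid : ℕ → Setoid _ _
  ≡-mod-setoid M = record
    { Carrier       = Series
    ; _≈_           = _≡_[mod M ]
    ; isEquivalence = record { refl = ≡-mod-refl ; sym = ≡-mod-sym ; trans = ≡-mod-trans }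
    }

  module ≡-mod-Reasoning (M : ℕ) = SetoidReasoning (≡-mod-setoid M)

  ⊛-cong-mod : ∀ {M a a′ b b′} →
    a ≡ a′ [mod M ] → b ≡ b′ [mod M ] → a ⊛ b ≡ a′ ⊛ b′ [mod M ]
  ⊛-cong-mod {M} {a} {a′} {b} {b′} a≡a′ b≡b′ = coefficientwise (coeff-⊛ a a′ (coeff a≡a′))
    where
    coeff-⊛ : ∀ a a′ → (∀ n → + M ∣ a n - a′ n) → ∀ n → + M ∣ (a ⊛ b) n - (a′ ⊛ b′) n
    coeff-⊛ a a′ a-a′ zero =
      ∣-diff-+ (a 0 * b 0) (a′ 0 * b′ 0) (+ 0) (+ 0)
        (∣-diff-* (a 0) (a′ 0) (b 0) (b′ 0) (a-a′ 0) (coeff b≡b′ 0))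
        (divides (+ 0) refl)
    coeff-⊛ a a′ a-a′ (suc n) =
      subst₂ (λ u v → + M ∣ u - v) (sym (tail-⊛ a b n)) (sym (tail-⊛ a′ b′ n))
        (∣-diff-+ (a 0 * b (suc n)) (a′ 0 * b′ (suc n)) ((tail a ⊛ b) n) ((tail a′ ⊛ b′) n)
          (∣-diff-* (a 0) (a′ 0) (b (suc n)) (b′ (suc n)) (a-a′ 0) (coeff b≡b′ (suc n)))
          (coeff-⊛ (tail a) (tail a′) (a-a′ ∘ suc) n))

  ⊛-congˡ-mod : ∀ {M} a {b b′} → b ≡ b′ [mod M ] → a ⊛ b ≡ a ⊛ b′ [mod M ]
  ⊛-congˡ-mod a = ⊛-cong-mod {a = a} {a} ≡-mod-refl

  ⊛-congʳ-mod : ∀ {M a a′} b → a ≡ a′ [mod M ] → a ⊛ b ≡ a′ ⊛ b [mod M ]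
  ⊛-congʳ-mod {a = a} {a′} b a≡a′ = ⊛-cong-mod {a = a} {a′} {b} {b} a≡a′ ≡-mod-refl

  powS-cong-mod : ∀ {M a b} k → a ≡ b [mod M ] → powS a k ≡ powS b k [mod M ]
  powS-cong-mod zero    a≡b = ≡-mod-refl
  powS-cong-mod (suc k) a≡b = ⊛-cong-mod a≡b (powS-cong-mod k a≡b)

  prodTo-cong-mod : ∀ {M F G} → (∀ k → F (suc k) ≡ G (suc k) [mod M ]) →
                    ∀ N → prodTo F N ≡ prodTo G N [mod M ]
  prodTo-cong-mod F≡G zero    = ≡-mod-refl
  prodTo-cong-mod F≡G (suc N) = ⊛-cong-mod (F≡G N) (prodTo-cong-mod F≡G N)

  quotients : ∀ {M a b} → a ≡ b [mod M ] → Series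
  quotients a≡b n = _∣_.quotient (coeff a≡b n)

  ≡-mod⇒≗+· : ∀ {M a b} (a≡b : a ≡ b [mod M ]) → a ≗ b +ₛ + M · quotients a≡b
  ≡-mod⇒≗+· {M} {a} {b} a≡b n = begin
    a n                    ≡⟨ split (a n) (b n) ⟩
    b n + (a n - b n)      ≡⟨ cong (_+_ (b n)) (_∣_.equality (coeff a≡b n)) ⟩
    b n + quotient * + M   ≡⟨ cong (_+_ (b n)) (ℤₚ.*-comm quotient (+ M)) ⟩
    b n + + M * quotient   ∎
    where
    open ≡-Reasoning
    open _∣_ (coeff a≡b n) using (quotient)
    split : ∀ x y → x ≡ y + (x - y)
    split = solve-∀

  -- Writing a = b + 2Q d gives a² - b² = 4Q (b d + Q d²).
  square-cong-mod-double : ∀ Q {a b} →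
    a ≡ b [mod 2 ℕ.* Q ] → a ⊛ a ≡ b ⊛ b [mod 2 ℕ.* (2 ℕ.* Q) ]
  square-cong-mod-double Q {a} {b} a≡b = coefficientwise λ n →
    divides ((b ⊛ d) n + + Q * (d ⊛ d) n) (begin
      (a ⊛ a) n - (b ⊛ b) n
        ≡⟨ cong (_- (b ⊛ b) n) (⊛-cong a≗b+Pd a≗b+Pd n) ⟩
      ((b +ₛ P · d) ⊛ (b +ₛ P · d)) n - (b ⊛ b) n
        ≡⟨ cong (_- (b ⊛ b) n) (expand n) ⟩
      ((b ⊛ b) n + P * (b ⊛ d) n) + P * ((b ⊛ d) n + P * (d ⊛ d) n) - (b ⊛ b) n
        ≡⟨ collect ((b ⊛ b) n) ((b ⊛ d) n) ((d ⊛ d) n) (+ Q) P (ℤₚ.pos-* 2 Q) ⟩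
      ((b ⊛ d) n + + Q * (d ⊛ d) n) * (+ 2 * P)
        ≡⟨ cong (λ p → ((b ⊛ d) n + + Q * (d ⊛ d) n) * p) (ℤₚ.pos-* 2 (2 ℕ.* Q)) ⟨
      ((b ⊛ d) n + + Q * (d ⊛ d) n) * + (2 ℕ.* (2 ℕ.* Q))
        ∎)
    where
    open ≡-Reasoning
    P = + (2 ℕ.* Q)
    d = quotients a≡b
    a≗b+Pd : a ≗ b +ₛ P · d
    a≗b+Pd = ≡-mod⇒≗+· a≡b
    expand : (b +ₛ P · d) ⊛ (b +ₛ P · d)
             ≗ (b ⊛ b +ₛ P · (b ⊛ d)) +ₛ P · (b ⊛ d +ₛ P · (d ⊛ d))
    expand n = begin
      ((b +ₛ P · d) ⊛ X) n
        ≡⟨ ⊛-distribʳ-+ₛ b (P · d) X n ⟩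
      (b ⊛ X) n + ((P · d) ⊛ X) n
        ≡⟨ cong₂ _+_ (⊛-distribˡ-+ₛ b b (P · d) n) (⊛-scalarˡ P d X n) ⟩
      ((b ⊛ b) n + (b ⊛ (P · d)) n) + P * (d ⊛ X) n
        ≡⟨ cong₂ (λ u v → ((b ⊛ b) n + u) + P * v)
                 (⊛-scalarʳ P b d n) (⊛-distribˡ-+ₛ d b (P · d) n) ⟩
      ((b ⊛ b) n + P * (b ⊛ d) n) + P * ((d ⊛ b) n + (d ⊛ (P · d)) n)
        ≡⟨ cong₂ (λ u v → ((b ⊛ b) n + P * (b ⊛ d) n) + P * (u + v))
                 (⊛-comm d b n) (⊛-scalarʳ P d d n) ⟩
      ((b ⊛ b) n + P * (b ⊛ d) n) + P * ((b ⊛ d) n + P * (d ⊛ d) n)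
        ∎
      where X = b +ₛ P · d
    collect : ∀ u v w q p → p ≡ + 2 * q →
              ((u + p * v) + p * (v + p * w)) - u ≡ (v + q * w) * (+ 2 * p)
    collect u v w q _ refl = ring u v w q
      where
      ring : ∀ u v w q →
             ((u + + 2 * q * v) + + 2 * q * (v + + 2 * q * w)) - u ≡ (v + q * w) * (+ 2 * (+ 2 * q))
      ring = solve-∀

  powS-2^-cong-mod : ∀ {a b} → a ≡ b [mod 2 ] → ∀ l →
                     powS a (2 ^ l) ≡ powS b (2 ^ l) [mod 2 ^ suc l ]
  powS-2^-cong-mod {a} {b} a≡b zero = begin
    powS a 1   ≈⟨ ≗⇒≡-mod (⊛-identityʳ a) ⟩
    a          ≈⟨ a≡b ⟩
    b          ≈⟨ ≗⇒≡-mod (⊛-identityʳ b) ⟨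
    powS b 1   ∎
    where open ≡-mod-Reasoning 2
  powS-2^-cong-mod {a} {b} a≡b (suc l) = begin
    powS a (2 ℕ.* 2 ^ l)              ≈⟨ ≗⇒≡-mod (powS-double a (2 ^ l)) ⟩
    powS a (2 ^ l) ⊛ powS a (2 ^ l)   ≈⟨ square-cong-mod-double (2 ^ l) (powS-2^-cong-mod a≡b l) ⟩
    powS b (2 ^ l) ⊛ powS b (2 ^ l)   ≈⟨ ≗⇒≡-mod (powS-double b (2 ^ l)) ⟨
    powS b (2 ℕ.* 2 ^ l)              ∎
    where open ≡-mod-Reasoning (2 ^ suc (suc l))

  powS-≡-square-mod-2^ : ∀ {a b} → a ≡ b ⊛ b [mod 2 ] → ∀ l m →
                         powS a (2 ^ l ℕ.* m) ≡ powS b (2 ℕ.* (2 ^ l ℕ.* m)) [mod 2 ^ suc l ]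
  powS-≡-square-mod-2^ {a} {b} a≡b² l m = begin
    powS a (2 ^ l ℕ.* m)
      ≈⟨ ≗⇒≡-mod (powS-*-assoc a (2 ^ l) m) ⟨
    powS (powS a (2 ^ l)) m
      ≈⟨ powS-cong-mod m (powS-2^-cong-mod a≡b² l) ⟩
    powS (powS (b ⊛ b) (2 ^ l)) m
      ≈⟨ ≗⇒≡-mod (powS-cong m (powS-cong (2 ^ l) (⊛-congˡ b (⊛-identityʳ b)))) ⟨
    powS (powS (powS b 2) (2 ^ l)) m
      ≈⟨ ≗⇒≡-mod (powS-cong m (powS-*-assoc b 2 (2 ^ l))) ⟩
    powS (powS b (2 ℕ.* 2 ^ l)) m
      ≈⟨ ≗⇒≡-mod (powS-*-assoc b (2 ℕ.* 2 ^ l) m) ⟩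
    powS b (2 ℕ.* 2 ^ l ℕ.* m)
      ≡⟨ cong (powS b) (ℕₚ.*-assoc 2 (2 ^ l) m) ⟩
    powS b (2 ℕ.* (2 ^ l ℕ.* m))
      ∎
    where open ≡-mod-Reasoning (2 ^ suc l)

  binomS-double-≡-square : ∀ j → binomS (2 ℕ.* suc j) ≡ binomS (suc j) ⊛ binomS (suc j) [mod 2 ]
  binomS-double-≡-square j = coefficientwise λ n →
    divides (x n - x² n) (begin
      binomS (2 ℕ.* s) n - (B ⊛ B) n
        ≡⟨ cong₂ _-_ (binomS-monomial _ n) (B⊛B n) ⟩
      (oneS n + -1ℤ * x² n) - ((oneS n + -1ℤ * x n) + -1ℤ * (x n + -1ℤ * x² n))
        ≡⟨ collect (oneS n) (x n) (x² n) ⟩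
      (x n - x² n) * + 2
        ∎)
    where
    open ≡-Reasoning
    s = suc j
    B = binomS s
    x = monomial s
    x² = monomial (2 ℕ.* s)
    x⊛x : x ⊛ x ≗ x²
    x⊛x n = begin
      (x ⊛ x) n              ≡⟨ monomial-⊛ s x n ⟩
      shift s x n            ≡⟨ shift-monomial s s n ⟩
      monomial (s ℕ.+ s) n   ≡⟨ cong (λ k → monomial (s ℕ.+ k) n) (ℕₚ.+-identityʳ s) ⟨
      x² n                   ∎
    x⊛B : x ⊛ B ≗ x +ₛ -1ℤ · x²
    x⊛B n = begin
      (x ⊛ B) n                          ≡⟨ ⊛-congˡ x (binomS-monomial j) n ⟩
      (x ⊛ (oneS +ₛ -1ℤ · x)) n          ≡⟨ ⊛-distribˡ-+ₛ x oneS (-1ℤ · x) n ⟩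
      (x ⊛ oneS) n + (x ⊛ (-1ℤ · x)) n   ≡⟨ cong₂ _+_ (⊛-identityʳ x n) (⊛-scalarʳ -1ℤ x x n) ⟩
      x n + -1ℤ * (x ⊛ x) n              ≡⟨ cong (λ y → x n + -1ℤ * y) (x⊛x n) ⟩
      x n + -1ℤ * x² n                   ∎
    B⊛B : B ⊛ B ≗ (oneS +ₛ -1ℤ · x) +ₛ -1ℤ · (x +ₛ -1ℤ · x²)
    B⊛B n = begin
      (B ⊛ B) n
        ≡⟨ ⊛-congʳ B (binomS-monomial j) n ⟩
      ((oneS +ₛ -1ℤ · x) ⊛ B) n
        ≡⟨ ⊛-distribʳ-+ₛ oneS (-1ℤ · x) B n ⟩
      (oneS ⊛ B) n + ((-1ℤ · x) ⊛ B) n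
        ≡⟨ cong₂ _+_ (⊛-identityˡ B n) (⊛-scalarˡ -1ℤ x B n) ⟩
      B n + -1ℤ * (x ⊛ B) n
        ≡⟨ cong₂ (λ y z → y + -1ℤ * z) (binomS-monomial j n) (x⊛B n) ⟩
      (oneS n + -1ℤ * x n) + -1ℤ * (x n + -1ℤ * x² n)
        ∎
    collect : ∀ u v w → (u + -1ℤ * w) - ((u + -1ℤ * v) + -1ℤ * (v + -1ℤ * w)) ≡ (v - w) * + 2
    collect = solve-∀

  f₂-exponent : ℕ → ℤ
  f₂-exponent c = - (+ (2 ℕ.* c) - + 3)

  f₂-exponent-+ : ∀ N c → f₂-exponent (N ℕ.+ c) + + (2 ℕ.* N) ≡ f₂-exponent c
  f₂-exponent-+ N c = begin
    - (+ (2 ℕ.* (N ℕ.+ c)) - + 3) + + (2 ℕ.* N)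
      ≡⟨ cong₂ (λ u v → - (u - + 3) + v) 2[N+c] (ℤₚ.pos-* 2 N) ⟩
    - (+ 2 * (+ N + + c) - + 3) + + 2 * + N
      ≡⟨ cancel (+ N) (+ c) ⟩
    - (+ 2 * + c - + 3)
      ≡⟨ cong (λ u → - (u - + 3)) (ℤₚ.pos-* 2 c) ⟨
    - (+ (2 ℕ.* c) - + 3)
      ∎
    where
    open ≡-Reasoning
    2[N+c] : + (2 ℕ.* (N ℕ.+ c)) ≡ + 2 * (+ N + + c)
    2[N+c] = trans (ℤₚ.pos-* 2 (N ℕ.+ c)) (cong (+ 2 *_) (ℤₚ.pos-+ N c))
    cancel : ∀ n c → - (+ 2 * (n + c) - + 3) + + 2 * n ≡ - (+ 2 * c - + 3)
    cancel = solve-∀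

  overcubicFactor-split : ∀ N t k → let A = binomS (4 ℕ.* k) in
    overcubicFactor (N ℕ.+ suc t) k
      ≗ powS A t ⊛ (factorPow k (- + 2)
          ⊛ (powS A N ⊛ factorPow (2 ℕ.* k) (f₂-exponent (N ℕ.+ suc t))))
  overcubicFactor-split N t k = begin
    overcubicFactor (N ℕ.+ suc t) k     ≡⟨ cong (λ w → factorPow (4 ℕ.* k) w ⊛ (H ⊛ F)) c-1≡t+N ⟩
    powS A (t ℕ.+ N) ⊛ (H ⊛ F)          ≈⟨ ⊛-congʳ (H ⊛ F) (powS-distribˡ-+ A t N) ⟩
    (powS A t ⊛ powS A N) ⊛ (H ⊛ F)     ≈⟨ ⊛-assoc (powS A t) (powS A N) (H ⊛ F) ⟩
    powS A t ⊛ (powS A N ⊛ (H ⊛ F))     ≈⟨ ⊛-congˡ (powS A t) (x⊛yz≗y⊛xz (powS A N) H F) ⟩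
    powS A t ⊛ (H ⊛ (powS A N ⊛ F))     ∎
    where
    open ≗-Reasoning
    A = binomS (4 ℕ.* k)
    H = factorPow k (- + 2)
    F = factorPow (2 ℕ.* k) (f₂-exponent (N ℕ.+ suc t))
    c-1≡t+N : + (N ℕ.+ suc t) - + 1 ≡ + (t ℕ.+ N)
    c-1≡t+N = trans (cong (λ i → + i - + 1) (ℕₚ.+-suc N t)) (cong +_ (ℕₚ.+-comm N t))

  overcubicFactor-cong : ∀ l m t k →
    overcubicFactor (2 ^ l ℕ.* m ℕ.+ suc t) (suc k) ≡ overcubicFactor (suc t) (suc k) [mod 2 ^ suc l ]
  overcubicFactor-cong l m t k = begin
    overcubicFactor (N ℕ.+ suc t) (suc k)
      ≈⟨ ≗⇒≡-mod (overcubicFactor-split N t (suc k)) ⟩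
    powS A t ⊛ (H ⊛ (powS A N ⊛ F e))
      ≈⟨ ⊛-congˡ-mod (powS A t) (⊛-congˡ-mod H (⊛-congʳ-mod (F e) A^N≡B^2N)) ⟩
    powS A t ⊛ (H ⊛ (powS B (2 ℕ.* N) ⊛ F e))
      ≈⟨ ≗⇒≡-mod (⊛-congˡ (powS A t) (⊛-congˡ H (powS-binomS-⊛-factorPow _ (2 ℕ.* N) e))) ⟩
    powS A t ⊛ (H ⊛ F (e + + (2 ℕ.* N)))
      ≡⟨ cong (λ w → powS A t ⊛ (H ⊛ F w)) (f₂-exponent-+ N (suc t)) ⟩
    overcubicFactor (suc t) (suc k)
      ∎
    where
    open ≡-mod-Reasoning (2 ^ suc l)
    N = 2 ^ l ℕ.* m
    e = f₂-exponent (N ℕ.+ suc t)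
    A = binomS (4 ℕ.* suc k)
    B = binomS (2 ℕ.* suc k)
    H = factorPow (suc k) (- + 2)
    F = factorPow (2 ℕ.* suc k)
    A≡B² : A ≡ B ⊛ B [mod 2 ]
    A≡B² = subst (λ i → binomS i ≡ B ⊛ B [mod 2 ])
                 (sym (ℕₚ.*-assoc 2 2 (suc k))) (binomS-double-≡-square _)
    A^N≡B^2N : powS A N ≡ powS B (2 ℕ.* N) [mod 2 ^ suc l ]
    A^N≡B^2N = powS-≡-square-mod-2^ A≡B² l m

  abar-cong : ∀ l m t n → + (2 ^ suc l) ∣ᵤ abar (2 ^ l ℕ.* m ℕ.+ suc t) n - abar (suc t) n
  abar-cong l m t n = ∣⇒∣ᵤ (coeff (prodTo-cong-mod (overcubicFactor-cong l m t) n) n)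


open import Data.Nat using (ℕ; _≤_; _^_; _*_; _+_; suc)
open import Data.Integer using (+_; _-_)
open import Data.Integer.Divisibility using (_∣_)
open import Defs

mainTheorem1 : (l m n t : ℕ) → 1 ≤ l → 1 ≤ t →
    (+ (2 ^ suc l)) ∣ (abar (2 ^ l * m + t) n - abar t n)
mainTheorem1 l m n (suc t) _ _ = OvercubicCongruence.abar-cong l m t n
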